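{- Let $A\in\mathbb{Z}$ with $A\equiv 1\pmod 4$, and for an integer $n\ge 3$ let \[\mathcal{F}_{n,A,A}(x)=x^{2^n}+Ax^{3\cdot 2^{n-2}}+Ax^{2^{n-1}}+Ax^{2^{n-2}}+1.\] Then $\mathcal{F}_{n,A,A}(x)$ is not monogenic.
   Context: A monic polynomial $f(x)\in\mathbb{Z}[x]$ is called monogenic if $f(x)$ is irreducible over $\mathbb{Q}$ and $\{1,\theta,\ldots,\theta^{\deg f-1}\}$ is a $\mathbb{Z}$-basis of the ring of integers of $\mathbb{Q}(\theta)$, where $f(\theta)=0$. -}

module Defs where

open import Data.Nat as ℕ using (ℕ; zero; suc; _^_; _∸_)
open import Data.Integer as ℤ using (ℤ; +_)
open import Data.Rational as ℚ using (ℚ; 0ℚ; 1ℚ)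
open import Data.List using (List; []; _∷_; replicate; _++_; map)
open import Data.Vec as V using (Vec)
open import Data.Fin using (Fin; toℕ)
open import Data.Product using (Σ; _×_; ∃)
open import Data.Sum using (_⊎_)
open import Relation.Binary.PropositionalEquality using (_≡_; _≢_)
open import Relation.Nullary using (¬_)

-- Polynomials as coefficient lists (constant term first).
-- Trailing zeros are allowed; equality of polynomials is coefficientwise.

ZPoly : Set
ZPoly = List ℤ

QPoly : Set
QPoly = List ℚ

coeffℤ : ZPoly → ℕ → ℤ
coeffℤ []       _       = + 0
coeffℤ (a ∷ p)  zero    = a
coeffℤ (a ∷ p)  (suc k) = coeffℤ p k

coeff : QPoly → ℕ → ℚ
coeff []       _       = 0ℚ
coeff (a ∷ p)  zero    = a
coeff (a ∷ p)  (suc k) = coeff p k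

_≈_ : QPoly → QPoly → Set
p ≈ q = ∀ k → coeff p k ≡ coeff q k

infix 4 _≈_

_+ᶻ_ : ZPoly → ZPoly → ZPoly
[]      +ᶻ q       = q
(a ∷ p) +ᶻ []      = a ∷ p
(a ∷ p) +ᶻ (b ∷ q) = (a ℤ.+ b) ∷ (p +ᶻ q)

infixl 6 _+ᶻ_

monℤ : ℤ → ℕ → ZPoly
monℤ c k = replicate k (+ 0) ++ (c ∷ [])

_+ᵖ_ : QPoly → QPoly → QPoly
[]      +ᵖ q       = q
(a ∷ p) +ᵖ []      = a ∷ p
(a ∷ p) +ᵖ (b ∷ q) = (a ℚ.+ b) ∷ (p +ᵖ q)

infixl 6 _+ᵖ_

scale : ℚ → QPoly → QPoly
scale c = map (c ℚ.*_)

_*ᵖ_ : QPoly → QPoly → QPoly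
[]      *ᵖ q = []
(a ∷ p) *ᵖ q = scale a q +ᵖ (0ℚ ∷ (p *ᵖ q))

infixl 7 _*ᵖ_

-ᵖ_ : QPoly → QPoly
-ᵖ_ = map (λ a → ℚ.- a)

_-ᵖ_ : QPoly → QPoly → QPoly
p -ᵖ q = p +ᵖ (-ᵖ q)

infixl 6 _-ᵖ_

ι : ℤ → ℚ
ι z = z ℚ./ 1

toQ : ZPoly → QPoly
toQ = map ι

xpow : ℕ → QPoly
xpow k = replicate k 0ℚ ++ (1ℚ ∷ [])

compose : ZPoly → QPoly → QPoly
compose []      g = []
compose (a ∷ h) g = (ι a ∷ []) +ᵖ (g *ᵖ compose h g)

_∣ᵖ_ : QPoly → QPoly → Set
f ∣ᵖ p = Σ QPoly λ q → p ≈ q *ᵖ f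

linComb : ∀ {d} → Vec ℤ d → QPoly
linComb c = toQ (V.toList c)

IsDegreeℤ : ZPoly → ℕ → Set
IsDegreeℤ p d = (coeffℤ p d ≢ + 0) × (∀ k → d ℕ.< k → coeffℤ p k ≡ + 0)

Monicℤ : ZPoly → Set
Monicℤ p = Σ ℕ λ d → IsDegreeℤ p d × (coeffℤ p d ≡ + 1)

IsConst : QPoly → Set
IsConst p = ∀ k → 1 ℕ.≤ k → coeff p k ≡ 0ℚ

-- f ∈ ℤ[x] is irreducible over ℚ: non-constant, and in every factorisation
-- f = g·h in ℚ[x] one factor is constant (a unit, as f ≠ 0).
IrreducibleQ : ZPoly → Set
IrreducibleQ f =
  (¬ IsConst (toQ f)) × (∀ g h → toQ f ≈ g *ᵖ h → IsConst g ⊎ IsConst h)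

-- Ring of integers of ℚ(θ), f(θ) = 0, f irreducible.
-- Every element of ℚ(θ) is g(θ) for some g ∈ ℚ[x]; g(θ) = g'(θ) iff f ∣ g - g'
-- in ℚ[x] (f being the minimal polynomial of θ).

IsAlgInt : ZPoly → QPoly → Set
IsAlgInt f g = Σ ZPoly λ h → Monicℤ h × (toQ f ∣ᵖ compose h g)

PowerBasisIsZBasis : ZPoly → ℕ → Set
PowerBasisIsZBasis f d =
    (∀ (i : Fin d) → IsAlgInt f (xpow (toℕ i)))
  × (∀ (c : Vec ℤ d) → toQ f ∣ᵖ linComb c → ∀ i → V.lookup c i ≡ + 0)
  × (∀ (g : QPoly) → IsAlgInt f g →
       Σ (Vec ℤ d) λ c → toQ f ∣ᵖ (g -ᵖ linComb c))

Monogenic : ZPoly → Set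
Monogenic f =
  IrreducibleQ f × (Σ ℕ λ d → IsDegreeℤ f d × PowerBasisIsZBasis f d)

F : ℕ → ℤ → ZPoly
F n A =
     monℤ (+ 1) (2 ^ n)
  +ᶻ monℤ A (3 ℕ.* 2 ^ (n ∸ 2))
  +ᶻ monℤ A (2 ^ (n ∸ 1))
  +ᶻ monℤ A (2 ^ (n ∸ 2))
  +ᶻ monℤ (+ 1) 0

-- Write A = 1 + 4k, n = m + 3, r = 2^m and z = x^r, so that F(x) = G(z) with
-- G(y) = y⁸ + A y⁶ + A y⁴ + A y² + 1.  The element α = (1 + z⁵)/2 of ℚ(θ) is
-- an algebraic integer: with ĥ(w) = 2⁸ h(w/2), where h is an explicit monic
-- polynomial of degree 8 with coefficients in ℤ[k], there is a polynomial
-- identity ĥ(1 + y⁵) = Q(y) G(y) in ℤ[k, y].  But α has degree 5r < deg F and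
-- constant coefficient 1/2, so it is not a ℤ-combination of 1, θ, …, θ^(deg F - 1).
module Submission where

open import Defs
open import Data.Nat using (ℕ; _≤_)
open import Data.Integer using (ℤ; +_; _-_)
open import Data.Integer.Divisibility using (_∣_)
open import Relation.Nullary using (¬_)

open import Algebra.Bundles using (CommutativeRing)
open import Data.Bool using (Bool; T)
open import Data.Empty using (⊥-elim)
open import Data.Fin using (zero; suc)
open import Data.Integer as ℤ using (-[1+_])
open import Data.Integer.Divisibility.Signed using (divides; ∣ᵤ⇒∣)
import Data.Integer.Properties as ℤP
import Data.Integer.Solver as ℤSolver
open import Data.List using (List; []; _∷_; map; length)
open import Data.Maybe using (nothing)
open import Data.Nat as ℕ using (zero; suc; _^_; _<_)
import Data.Nat.Coprimality as Coprime
import Data.Nat.Properties as ℕP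
open import Data.Product using (∃-syntax; _×_; _,_)
open import Data.Rational as ℚ using (ℚ; 0ℚ; 1ℚ; ½)
import Data.Rational.Properties as ℚP
open import Algebra.Properties.Group ℚP.+-0-group using (x∙y⁻¹≈ε⇒x≈y)
import Data.Rational.Solver as ℚSolver
import Data.Rational.Unnormalised as ℚᵘ
import Data.Rational.Unnormalised.Properties as ℚᵘP
open import Data.Sum using (_⊎_; inj₁; inj₂)
open import Data.Vec as Vec using (Vec; []; _∷_)
import Data.Vec.Properties as VecP
open import Function.Base using (_∘_; _⟨_⟩_)
open import Level using (0ℓ)
open import Relation.Binary.PropositionalEquality
open import Relation.Nullary using (yes; no)
open import Relation.Nullary.Decidable using (isYes)

-- Wrapping _≈_ in a record lets Agda infer p and q from a proof of p ≋ q.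
record _≋_ (p q : QPoly) : Set where
  constructor coeffwise
  field coeff-≡ : p ≈ q
open _≋_

infix 4 _≋_

≋-refl : ∀ {p} → p ≋ p
≋-refl = coeffwise λ _ → refl

≋-reflexive : ∀ {p q} → p ≡ q → p ≋ q
≋-reflexive refl = ≋-refl

≋-sym : ∀ {p q} → p ≋ q → q ≋ p
≋-sym (coeffwise e) = coeffwise (sym ∘ e)

≋-trans : ∀ {p q r} → p ≋ q → q ≋ r → p ≋ r
≋-trans (coeffwise e) (coeffwise e′) = coeffwise λ k → trans (e k) (e′ k)

∷-cong : ∀ {a b p q} → a ≡ b → p ≋ q → a ∷ p ≋ b ∷ q
∷-cong a≡b (coeffwise p≈q) = coeffwise λ where
  zero    → a≡b
  (suc k) → p≈q k

coeff-+ᵖ : ∀ p q k → coeff (p +ᵖ q) k ≡ coeff p k ℚ.+ coeff q k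
coeff-+ᵖ []      q       k       = sym (ℚP.+-identityˡ _)
coeff-+ᵖ (a ∷ p) []      k       = sym (ℚP.+-identityʳ _)
coeff-+ᵖ (a ∷ p) (b ∷ q) zero    = refl
coeff-+ᵖ (a ∷ p) (b ∷ q) (suc k) = coeff-+ᵖ p q k

coeff-scale : ∀ c p k → coeff (scale c p) k ≡ c ℚ.* coeff p k
coeff-scale c []      k       = sym (ℚP.*-zeroʳ c)
coeff-scale c (a ∷ p) zero    = refl
coeff-scale c (a ∷ p) (suc k) = coeff-scale c p k

coeff--ᵖ : ∀ p k → coeff (-ᵖ p) k ≡ ℚ.- coeff p k
coeff--ᵖ []      k       = refl
coeff--ᵖ (a ∷ p) zero    = refl
coeff--ᵖ (a ∷ p) (suc k) = coeff--ᵖ p k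

coeff--ᵖ-distrib : ∀ p q k → coeff (p -ᵖ q) k ≡ coeff p k ℚ.- coeff q k
coeff--ᵖ-distrib p q k = trans (coeff-+ᵖ p (-ᵖ q) k) (cong (coeff p k ℚ.+_) (coeff--ᵖ q k))

+ᵖ-cong : ∀ {p p′ q q′} → p ≋ p′ → q ≋ q′ → p +ᵖ q ≋ p′ +ᵖ q′
+ᵖ-cong {p} {p′} {q} {q′} (coeffwise e) (coeffwise e′) = coeffwise λ k → begin
  coeff (p +ᵖ q) k           ≡⟨ coeff-+ᵖ p q k ⟩
  coeff p k ℚ.+ coeff q k    ≡⟨ cong₂ ℚ._+_ (e k) (e′ k) ⟩
  coeff p′ k ℚ.+ coeff q′ k  ≡⟨ coeff-+ᵖ p′ q′ k ⟨
  coeff (p′ +ᵖ q′) k         ∎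
  where open ≡-Reasoning

+ᵖ-assoc : ∀ p q r → (p +ᵖ q) +ᵖ r ≋ p +ᵖ (q +ᵖ r)
+ᵖ-assoc p q r = coeffwise λ k → begin
  coeff ((p +ᵖ q) +ᵖ r) k                    ≡⟨ coeff-+ᵖ (p +ᵖ q) r k ⟩
  coeff (p +ᵖ q) k ℚ.+ coeff r k             ≡⟨ cong (ℚ._+ coeff r k) (coeff-+ᵖ p q k) ⟩
  (coeff p k ℚ.+ coeff q k) ℚ.+ coeff r k    ≡⟨ ℚP.+-assoc (coeff p k) _ _ ⟩
  coeff p k ℚ.+ (coeff q k ℚ.+ coeff r k)    ≡⟨ cong (coeff p k ℚ.+_) (coeff-+ᵖ q r k) ⟨
  coeff p k ℚ.+ coeff (q +ᵖ r) k             ≡⟨ coeff-+ᵖ p (q +ᵖ r) k ⟨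
  coeff (p +ᵖ (q +ᵖ r)) k                    ∎
  where open ≡-Reasoning

+ᵖ-comm : ∀ p q → p +ᵖ q ≋ q +ᵖ p
+ᵖ-comm p q = coeffwise λ k →
  trans (coeff-+ᵖ p q k) (trans (ℚP.+-comm (coeff p k) _) (sym (coeff-+ᵖ q p k)))

+ᵖ-identityʳ : ∀ p → p +ᵖ [] ≋ p
+ᵖ-identityʳ p = coeffwise λ k → trans (coeff-+ᵖ p [] k) (ℚP.+-identityʳ _)

-ᵖ-inverseʳ : ∀ p → p +ᵖ (-ᵖ p) ≋ []
-ᵖ-inverseʳ p = coeffwise λ k →
  trans (coeff--ᵖ-distrib p p k) (ℚP.+-inverseʳ (coeff p k))

-ᵖ-inverseˡ : ∀ p → (-ᵖ p) +ᵖ p ≋ []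
-ᵖ-inverseˡ p = ≋-trans (+ᵖ-comm (-ᵖ p) p) (-ᵖ-inverseʳ p)

-ᵖ-cong : ∀ {p q} → p ≋ q → -ᵖ p ≋ -ᵖ q
-ᵖ-cong {p} {q} (coeffwise e) = coeffwise λ k →
  trans (coeff--ᵖ p k) (trans (cong ℚ.-_ (e k)) (sym (coeff--ᵖ q k)))

coeff-∷-*ᵖ : ∀ a p q k → coeff ((a ∷ p) *ᵖ q) k ≡ a ℚ.* coeff q k ℚ.+ coeff (0ℚ ∷ (p *ᵖ q)) k
coeff-∷-*ᵖ a p q k =
  trans (coeff-+ᵖ (scale a q) _ k) (cong (ℚ._+ coeff (0ℚ ∷ (p *ᵖ q)) k) (coeff-scale a q k))

*ᵖ-zeroˡ : ∀ {p} q → p ≋ [] → p *ᵖ q ≋ []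
*ᵖ-zeroˡ {[]}    q _                   = ≋-refl
*ᵖ-zeroˡ {a ∷ p} q (coeffwise a∷p≈[]) = coeffwise λ k → begin
  coeff ((a ∷ p) *ᵖ q) k                       ≡⟨ coeff-∷-*ᵖ a p q k ⟩
  a ℚ.* coeff q k ℚ.+ coeff (0ℚ ∷ (p *ᵖ q)) k  ≡⟨ cong₂ ℚ._+_ (cong (ℚ._* coeff q k) (a∷p≈[] zero)) (tail≈0 k) ⟩
  0ℚ ℚ.* coeff q k ℚ.+ 0ℚ                      ≡⟨ trans (ℚP.+-identityʳ (0ℚ ℚ.* coeff q k)) (ℚP.*-zeroˡ (coeff q k)) ⟩
  0ℚ                                           ∎
  where
  open ≡-Reasoning
  tail≈0 : ∀ k → coeff (0ℚ ∷ (p *ᵖ q)) k ≡ 0ℚ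
  tail≈0 zero    = refl
  tail≈0 (suc k) = coeff-≡ (*ᵖ-zeroˡ {p} q (coeffwise (a∷p≈[] ∘ suc))) k

*ᵖ-zeroʳ : ∀ p → p *ᵖ [] ≋ []
*ᵖ-zeroʳ []      = ≋-refl
*ᵖ-zeroʳ (a ∷ p) = coeffwise λ where
  zero    → refl
  (suc k) → coeff-≡ (*ᵖ-zeroʳ p) k

*ᵖ-congʳ : ∀ {p p′} q → p ≋ p′ → p *ᵖ q ≋ p′ *ᵖ q
*ᵖ-congʳ {[]}    {[]}     q _ = ≋-refl
*ᵖ-congʳ {[]}    {b ∷ p′} q e = ≋-sym (*ᵖ-zeroˡ q (≋-sym e))
*ᵖ-congʳ {a ∷ p} {[]}     q e = *ᵖ-zeroˡ q e
*ᵖ-congʳ {a ∷ p} {b ∷ p′} q (coeffwise e) =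
  +ᵖ-cong (≋-reflexive (cong (λ c → scale c q) (e zero)))
          (∷-cong refl (*ᵖ-congʳ {p} {p′} q (coeffwise (e ∘ suc))))

0∷-*ᵖ : ∀ p q → (0ℚ ∷ p) *ᵖ q ≋ 0ℚ ∷ (p *ᵖ q)
0∷-*ᵖ p q = coeffwise λ k →
  trans (coeff-∷-*ᵖ 0ℚ p q k)
        (trans (cong (ℚ._+ coeff (0ℚ ∷ (p *ᵖ q)) k) (ℚP.*-zeroˡ (coeff q k))) (ℚP.+-identityˡ _))

*ᵖ-distribʳ : ∀ r p q → (p +ᵖ q) *ᵖ r ≋ p *ᵖ r +ᵖ q *ᵖ r
*ᵖ-distribʳ r []      q       = ≋-refl
*ᵖ-distribʳ r (a ∷ p) []      = ≋-sym (+ᵖ-identityʳ _)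
*ᵖ-distribʳ r (a ∷ p) (b ∷ q) = coeffwise λ k → begin
  coeff (((a ℚ.+ b) ∷ (p +ᵖ q)) *ᵖ r) k
    ≡⟨ coeff-∷-*ᵖ (a ℚ.+ b) (p +ᵖ q) r k ⟩
  (a ℚ.+ b) ℚ.* coeff r k ℚ.+ coeff (0ℚ ∷ ((p +ᵖ q) *ᵖ r)) k
    ≡⟨ cong ((a ℚ.+ b) ℚ.* coeff r k ℚ.+_) (tails k) ⟩
  (a ℚ.+ b) ℚ.* coeff r k ℚ.+ (coeff (0ℚ ∷ (p *ᵖ r)) k ℚ.+ coeff (0ℚ ∷ (q *ᵖ r)) k)
    ≡⟨ solve 5 (λ a b x u v → (a :+ b) :* x :+ (u :+ v) := (a :* x :+ u) :+ (b :* x :+ v))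
             refl a b (coeff r k) (coeff (0ℚ ∷ (p *ᵖ r)) k) (coeff (0ℚ ∷ (q *ᵖ r)) k) ⟩
  (a ℚ.* coeff r k ℚ.+ coeff (0ℚ ∷ (p *ᵖ r)) k) ℚ.+ (b ℚ.* coeff r k ℚ.+ coeff (0ℚ ∷ (q *ᵖ r)) k)
    ≡⟨ cong₂ ℚ._+_ (coeff-∷-*ᵖ a p r k) (coeff-∷-*ᵖ b q r k) ⟨
  coeff ((a ∷ p) *ᵖ r) k ℚ.+ coeff ((b ∷ q) *ᵖ r) k
    ≡⟨ coeff-+ᵖ ((a ∷ p) *ᵖ r) _ k ⟨
  coeff ((a ∷ p) *ᵖ r +ᵖ (b ∷ q) *ᵖ r) k
    ∎
  where
  open ≡-Reasoning
  open ℚSolver.+-*-Solver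
  tails : ∀ k → coeff (0ℚ ∷ ((p +ᵖ q) *ᵖ r)) k ≡ coeff (0ℚ ∷ (p *ᵖ r)) k ℚ.+ coeff (0ℚ ∷ (q *ᵖ r)) k
  tails zero    = sym (ℚP.+-identityʳ 0ℚ)
  tails (suc k) = trans (coeff-≡ (*ᵖ-distribʳ r p q) k) (coeff-+ᵖ (p *ᵖ r) (q *ᵖ r) k)

scale-*ᵖ : ∀ c p q → scale c p *ᵖ q ≋ scale c (p *ᵖ q)
scale-*ᵖ c []      q = ≋-refl
scale-*ᵖ c (b ∷ p) q = coeffwise λ k → begin
  coeff ((c ℚ.* b ∷ scale c p) *ᵖ q) k
    ≡⟨ coeff-∷-*ᵖ (c ℚ.* b) (scale c p) q k ⟩
  c ℚ.* b ℚ.* coeff q k ℚ.+ coeff (0ℚ ∷ (scale c p *ᵖ q)) k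
    ≡⟨ cong (c ℚ.* b ℚ.* coeff q k ℚ.+_) (tails k) ⟩
  c ℚ.* b ℚ.* coeff q k ℚ.+ c ℚ.* coeff (0ℚ ∷ (p *ᵖ q)) k
    ≡⟨ solve 4 (λ c b x u → c :* b :* x :+ c :* u := c :* (b :* x :+ u))
             refl c b (coeff q k) (coeff (0ℚ ∷ (p *ᵖ q)) k) ⟩
  c ℚ.* (b ℚ.* coeff q k ℚ.+ coeff (0ℚ ∷ (p *ᵖ q)) k)
    ≡⟨ cong (c ℚ.*_) (coeff-∷-*ᵖ b p q k) ⟨
  c ℚ.* coeff ((b ∷ p) *ᵖ q) k
    ≡⟨ coeff-scale c ((b ∷ p) *ᵖ q) k ⟨
  coeff (scale c ((b ∷ p) *ᵖ q)) k
    ∎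
  where
  open ≡-Reasoning
  open ℚSolver.+-*-Solver
  tails : ∀ k → coeff (0ℚ ∷ (scale c p *ᵖ q)) k ≡ c ℚ.* coeff (0ℚ ∷ (p *ᵖ q)) k
  tails zero    = sym (ℚP.*-zeroʳ c)
  tails (suc k) = trans (coeff-≡ (scale-*ᵖ c p q) k) (coeff-scale c (p *ᵖ q) k)

*ᵖ-assoc : ∀ p q r → (p *ᵖ q) *ᵖ r ≋ p *ᵖ (q *ᵖ r)
*ᵖ-assoc []      q r = ≋-refl
*ᵖ-assoc (a ∷ p) q r =
  ≋-trans (*ᵖ-distribʳ r (scale a q) (0ℚ ∷ (p *ᵖ q)))
          (+ᵖ-cong (scale-*ᵖ a q r) (≋-trans (0∷-*ᵖ (p *ᵖ q) r) (∷-cong refl (*ᵖ-assoc p q r))))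

*ᵖ-∷ʳ : ∀ p b q → p *ᵖ (b ∷ q) ≋ scale b p +ᵖ (0ℚ ∷ (p *ᵖ q))
*ᵖ-∷ʳ []      b q = coeffwise λ where
  zero    → refl
  (suc k) → refl
*ᵖ-∷ʳ (a ∷ p) b q =
  ∷-cong (cong (ℚ._+ 0ℚ) (ℚP.*-comm a b))
    (≋-trans (+ᵖ-cong (≋-refl {scale a q}) (*ᵖ-∷ʳ p b q))
    (≋-trans (≋-sym (+ᵖ-assoc (scale a q) (scale b p) _))
    (≋-trans (+ᵖ-cong (+ᵖ-comm (scale a q) (scale b p)) ≋-refl)
             (+ᵖ-assoc (scale b p) (scale a q) _))))

*ᵖ-comm : ∀ p q → p *ᵖ q ≋ q *ᵖ p
*ᵖ-comm []      q = ≋-sym (*ᵖ-zeroʳ q)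
*ᵖ-comm (a ∷ p) q = ≋-sym (≋-trans (*ᵖ-∷ʳ q a p) (+ᵖ-cong ≋-refl (∷-cong refl (*ᵖ-comm q p))))

*ᵖ-congˡ : ∀ p {q q′} → q ≋ q′ → p *ᵖ q ≋ p *ᵖ q′
*ᵖ-congˡ p {q} {q′} e = ≋-trans (*ᵖ-comm p q) (≋-trans (*ᵖ-congʳ p e) (*ᵖ-comm q′ p))

*ᵖ-cong : ∀ {p p′ q q′} → p ≋ p′ → q ≋ q′ → p *ᵖ q ≋ p′ *ᵖ q′
*ᵖ-cong {p′ = p′} {q = q} e e′ = ≋-trans (*ᵖ-congʳ q e) (*ᵖ-congˡ p′ e′)

1ᵖ : QPoly
1ᵖ = 1ℚ ∷ []

[0]≋[] : 0ℚ ∷ [] ≋ []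
[0]≋[] = coeffwise λ where
  zero    → refl
  (suc k) → refl

∷[]-*ᵖ : ∀ a p → (a ∷ []) *ᵖ p ≋ scale a p
∷[]-*ᵖ a p = ≋-trans (+ᵖ-cong ≋-refl [0]≋[]) (+ᵖ-identityʳ (scale a p))

*ᵖ-identityˡ : ∀ p → 1ᵖ *ᵖ p ≋ p
*ᵖ-identityˡ p = coeffwise λ k →
  trans (coeff-≡ (∷[]-*ᵖ 1ℚ p) k) (trans (coeff-scale 1ℚ p k) (ℚP.*-identityˡ _))

*ᵖ-identityʳ : ∀ p → p *ᵖ 1ᵖ ≋ p
*ᵖ-identityʳ p = ≋-trans (*ᵖ-comm p 1ᵖ) (*ᵖ-identityˡ p)

*ᵖ-distribˡ : ∀ p q r → p *ᵖ (q +ᵖ r) ≋ p *ᵖ q +ᵖ p *ᵖ r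
*ᵖ-distribˡ p q r =
  ≋-trans (*ᵖ-comm p _) (≋-trans (*ᵖ-distribʳ p q r) (+ᵖ-cong (*ᵖ-comm q p) (*ᵖ-comm r p)))

ℚ[x]-commutativeRing : CommutativeRing 0ℓ 0ℓ
ℚ[x]-commutativeRing = record
  { Carrier = QPoly
  ; _≈_ = _≋_
  ; _+_ = _+ᵖ_
  ; _*_ = _*ᵖ_
  ; -_ = -ᵖ_
  ; 0# = []
  ; 1# = 1ᵖ
  ; isCommutativeRing = record
    { isRing = record
      { +-isAbelianGroup = record
        { isGroup = record
          { isMonoid = record
            { isSemigroup = record
              { isMagma = record
                { isEquivalence = record { refl = ≋-refl ; sym = ≋-sym ; trans = ≋-trans }
                ; ∙-cong = +ᵖ-cong }
              ; assoc = +ᵖ-assoc }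
            ; identity = (λ _ → ≋-refl) , +ᵖ-identityʳ }
          ; inverse = -ᵖ-inverseˡ , -ᵖ-inverseʳ
          ; ⁻¹-cong = -ᵖ-cong }
        ; comm = +ᵖ-comm }
      ; *-cong = *ᵖ-cong
      ; *-assoc = *ᵖ-assoc
      ; *-identity = *ᵖ-identityˡ , *ᵖ-identityʳ
      ; distrib = *ᵖ-distribˡ , *ᵖ-distribʳ }
    ; *-comm = *ᵖ-comm } }

open CommutativeRing ℚ[x]-commutativeRing using () renaming (setoid to ≋-setoid)

[_]ᶜ : ℤ → QPoly
[ c ]ᶜ = ι c ∷ []

toℚᵘ-ι : ∀ c → ℚ.toℚᵘ (ι c) ℚᵘ.≃ ℚᵘ.mkℚᵘ c 0
toℚᵘ-ι c = ℚP.toℚᵘ-fromℚᵘ (ℚᵘ.mkℚᵘ c 0)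

ι-+ : ∀ a b → ι (a ℤ.+ b) ≡ ι a ℚ.+ ι b
ι-+ a b = ℚP.toℚᵘ-injective (ℚᵘP.≃-trans (toℚᵘ-ι (a ℤ.+ b))
  (ℚᵘP.≃-trans (ℚᵘ.*≡* (solve 2 (λ a b → (a :+ b) :* con (+ 1) := (a :* con (+ 1) :+ b :* con (+ 1)) :* con (+ 1)) refl a b))
  (ℚᵘP.≃-sym (ℚᵘP.≃-trans (ℚP.toℚᵘ-homo-+ (ι a) (ι b)) (ℚᵘP.+-cong (toℚᵘ-ι a) (toℚᵘ-ι b))))))
  where open ℤSolver.+-*-Solver

ι-* : ∀ a b → ι (a ℤ.* b) ≡ ι a ℚ.* ι b
ι-* a b = ℚP.toℚᵘ-injective (ℚᵘP.≃-trans (toℚᵘ-ι (a ℤ.* b))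
  (ℚᵘP.≃-sym (ℚᵘP.≃-trans (ℚP.toℚᵘ-homo-* (ι a) (ι b)) (ℚᵘP.*-cong (toℚᵘ-ι a) (toℚᵘ-ι b)))))

ι-neg : ∀ a → ι (ℤ.- a) ≡ ℚ.- ι a
ι-neg a = ℚP.toℚᵘ-injective (ℚᵘP.≃-trans (toℚᵘ-ι (ℤ.- a))
  (ℚᵘP.≃-sym (ℚᵘP.≃-trans (ℚP.toℚᵘ-homo‿- (ι a)) (ℚᵘP.-‿cong (toℚᵘ-ι a)))))

ι-≡-mkℚ : ∀ c → ι c ≡ ℚ.mkℚ c 0 (Coprime.sym (Coprime.1-coprimeTo ℤ.∣ c ∣))
ι-≡-mkℚ (+ m)    = ℚP.normalize-coprime (Coprime.sym (Coprime.1-coprimeTo m))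
ι-≡-mkℚ -[1+ m ] = cong ℚ.-_ (ℚP.normalize-coprime (Coprime.sym (Coprime.1-coprimeTo (suc m))))

ι≡0⇒≡0 : ∀ c → ι c ≡ 0ℚ → c ≡ + 0
ι≡0⇒≡0 c ιc≡0 = trans (sym (cong ℚ.numerator (ι-≡-mkℚ c))) (cong ℚ.numerator ιc≡0)

[]ᶜ-+ : ∀ a b → [ a ℤ.+ b ]ᶜ ≋ [ a ]ᶜ +ᵖ [ b ]ᶜ
[]ᶜ-+ a b = ∷-cong (ι-+ a b) ≋-refl

[]ᶜ-* : ∀ a b → [ a ℤ.* b ]ᶜ ≋ [ a ]ᶜ *ᵖ [ b ]ᶜ
[]ᶜ-* a b = ∷-cong (trans (ι-* a b) (sym (ℚP.+-identityʳ _))) ≋-refl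

½≢ι : ∀ c → ½ ≢ ι c
½≢ι c ½≡ιc with cong ℚ.denominator-1 (trans ½≡ιc (ι-≡-mkℚ c))
... | ()

-- Tactic.RingSolver.NonReflective takes its constants from the ring itself, where
-- equality is not decidable by evaluation; with constants in ℤ, normal forms of
-- closed identities are compared by computation.

module ℤCoefficientSolver where
  open import Algebra.Properties.Semiring.Exp.TCOptimised using (^-congˡ)
  open import Tactic.RingSolver.Core.AlmostCommutativeRing
  open import Tactic.RingSolver.Core.Expression public
  open import Tactic.RingSolver.Core.Polynomial.Parameters using (Homomorphism)

  ℚ[x]-almostCommutativeRing : AlmostCommutativeRing 0ℓ 0ℓ
  ℚ[x]-almostCommutativeRing = fromCommutativeRing ℚ[x]-commutativeRing (λ _ → nothing)

  open AlmostCommutativeRing ℚ[x]-almostCommutativeRing using (rawRing; semiring)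

  [_]ᶜ-morphism : ℤ.+-*-rawRing -Raw-AlmostCommutative⟶ ℚ[x]-almostCommutativeRing
  [_]ᶜ-morphism = record
    { ⟦_⟧    = [_]ᶜ
    ; +-homo = []ᶜ-+
    ; *-homo = []ᶜ-*
    ; -‿homo = λ a → ∷-cong (ι-neg a) ≋-refl
    ; 0-homo = [0]≋[]
    ; 1-homo = ≋-refl }

  isZero : ℤ → Bool
  isZero c = isYes (c ℤ.≟ + 0)

  isZero-sound : ∀ c → T (isZero c) → [] ≋ [ c ]ᶜ
  isZero-sound (+ 0) _ = ≋-sym [0]≋[]

  homomorphism : Homomorphism 0ℓ 0ℓ 0ℓ 0ℓ
  homomorphism = record
    { from = record { rawRing = ℤ.+-*-rawRing ; isZero = isZero }
    ; to = ℚ[x]-almostCommutativeRing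
    ; morphism = [_]ᶜ-morphism
    ; Zero-C⟶Zero-R = isZero-sound }

  open Eval rawRing [_]ᶜ public
  open import Tactic.RingSolver.Core.Polynomial.Base (Homomorphism.from homomorphism)
    renaming (ι to var)

  norm : ∀ {n} → Expr ℤ n → Poly n
  norm (Κ x)   = κ x
  norm (Ι x)   = var x
  norm (x ⊕ y) = norm x ⊞ norm y
  norm (x ⊗ y) = norm x ⊠ norm y
  norm (⊝ x)   = ⊟ norm x
  norm (x ⊛ i) = norm x ⊡ i

  ⟦_⇓⟧ : ∀ {n} → Expr ℤ n → Vec QPoly n → QPoly
  ⟦ e ⇓⟧ = ⟦ norm e ⟧ₚ
    where open import Tactic.RingSolver.Core.Polynomial.Semantics homomorphism renaming (⟦_⟧ to ⟦_⟧ₚ)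

  correct : ∀ {n} (e : Expr ℤ n) ρ → ⟦ e ⇓⟧ ρ ≋ ⟦ e ⟧ ρ
  correct {n} = go
    where
    open import Tactic.RingSolver.Core.Polynomial.Homomorphism homomorphism
    go : ∀ (e : Expr ℤ n) ρ → ⟦ e ⇓⟧ ρ ≋ ⟦ e ⟧ ρ
    go (Κ x)   ρ = κ-hom x ρ
    go (Ι x)   ρ = ι-hom x ρ
    go (x ⊕ y) ρ = ⊞-hom (norm x) (norm y) ρ ⟨ ≋-trans ⟩ +ᵖ-cong (go x ρ) (go y ρ)
    go (x ⊗ y) ρ = ⊠-hom (norm x) (norm y) ρ ⟨ ≋-trans ⟩ *ᵖ-cong (go x ρ) (go y ρ)
    go (⊝ x)   ρ = ⊟-hom (norm x) ρ ⟨ ≋-trans ⟩ -ᵖ-cong (go x ρ)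
    go (x ⊛ i) ρ = ⊡-hom (norm x) i ρ ⟨ ≋-trans ⟩ ^-congˡ semiring i (go x ρ)

  open import Relation.Binary.Reflection ≋-setoid Ι ⟦_⟧ ⟦_⇓⟧ correct public using (prove)

open ℤCoefficientSolver using (Expr; Κ; Ι; _⊕_; _⊗_; _⊛_; ⟦_⟧; prove)

coeffℤ-+ᶻ : ∀ p q k → coeffℤ (p +ᶻ q) k ≡ coeffℤ p k ℤ.+ coeffℤ q k
coeffℤ-+ᶻ []      q       k       = sym (ℤP.+-identityˡ _)
coeffℤ-+ᶻ (a ∷ p) []      k       = sym (ℤP.+-identityʳ _)
coeffℤ-+ᶻ (a ∷ p) (b ∷ q) zero    = refl
coeffℤ-+ᶻ (a ∷ p) (b ∷ q) (suc k) = coeffℤ-+ᶻ p q k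

coeffℤ-≥length : ∀ p {k} → length p ≤ k → coeffℤ p k ≡ + 0
coeffℤ-≥length []      _           = refl
coeffℤ-≥length (a ∷ p) (ℕ.s≤s le) = coeffℤ-≥length p le

coeffℤ-monℤ-≡ : ∀ c e → coeffℤ (monℤ c e) e ≡ c
coeffℤ-monℤ-≡ c zero    = refl
coeffℤ-monℤ-≡ c (suc e) = coeffℤ-monℤ-≡ c e

coeffℤ-monℤ-< : ∀ c {e j} → e < j → coeffℤ (monℤ c e) j ≡ + 0
coeffℤ-monℤ-< c {zero}  {suc j} _          = refl
coeffℤ-monℤ-< c {suc e} {suc j} (ℕ.s≤s lt) = coeffℤ-monℤ-< c lt

coeffℤ-+ᶻ-monℤ-< : ∀ p c {e j} → e < j → coeffℤ (p +ᶻ monℤ c e) j ≡ coeffℤ p j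
coeffℤ-+ᶻ-monℤ-< p c {e} {j} e<j = begin
  coeffℤ (p +ᶻ monℤ c e) j             ≡⟨ coeffℤ-+ᶻ p (monℤ c e) j ⟩
  coeffℤ p j ℤ.+ coeffℤ (monℤ c e) j   ≡⟨ cong (ℤ._+_ (coeffℤ p j)) (coeffℤ-monℤ-< c e<j) ⟩
  coeffℤ p j ℤ.+ + 0                   ≡⟨ ℤP.+-identityʳ (coeffℤ p j) ⟩
  coeffℤ p j                           ∎
  where open ≡-Reasoning

coeffℤ≢0⇒≤degree : ∀ {p d e} → IsDegreeℤ p d → coeffℤ p e ≢ + 0 → e ≤ d
coeffℤ≢0⇒≤degree {e = e} (_ , vanishes) pₑ≢0 with e ℕ.≤? _
... | yes e≤d = e≤d
... | no  e≰d = ⊥-elim (pₑ≢0 (vanishes e (ℕP.≰⇒> e≰d)))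

coeff-toQ : ∀ p k → coeff (toQ p) k ≡ ι (coeffℤ p k)
coeff-toQ []      k       = refl
coeff-toQ (a ∷ p) zero    = refl
coeff-toQ (a ∷ p) (suc k) = coeff-toQ p k

toQ-+ᶻ : ∀ {p q P Q} → toQ p ≋ P → toQ q ≋ Q → toQ (p +ᶻ q) ≋ P +ᵖ Q
toQ-+ᶻ {p} {q} p≋P q≋Q = ≋-trans +-homo (+ᵖ-cong p≋P q≋Q)
  where
  +-homo : toQ (p +ᶻ q) ≋ toQ p +ᵖ toQ q
  +-homo = coeffwise λ k → begin
    coeff (toQ (p +ᶻ q)) k                ≡⟨ coeff-toQ (p +ᶻ q) k ⟩
    ι (coeffℤ (p +ᶻ q) k)                 ≡⟨ cong ι (coeffℤ-+ᶻ p q k) ⟩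
    ι (coeffℤ p k ℤ.+ coeffℤ q k)         ≡⟨ ι-+ (coeffℤ p k) (coeffℤ q k) ⟩
    ι (coeffℤ p k) ℚ.+ ι (coeffℤ q k)     ≡⟨ cong₂ ℚ._+_ (coeff-toQ p k) (coeff-toQ q k) ⟨
    coeff (toQ p) k ℚ.+ coeff (toQ q) k   ≡⟨ coeff-+ᵖ (toQ p) (toQ q) k ⟨
    coeff (toQ p +ᵖ toQ q) k              ∎
    where open ≡-Reasoning

toQ-monℤ : ∀ c e → toQ (monℤ c e) ≋ [ c ]ᶜ *ᵖ xpow e
toQ-monℤ c zero    = ∷-cong (sym (trans (ℚP.+-identityʳ _) (ℚP.*-identityʳ (ι c)))) ≋-refl
toQ-monℤ c (suc e) =
  ≋-trans (∷-cong (sym (trans (ℚP.+-identityʳ _) (ℚP.*-zeroˡ (ι c)))) (toQ-monℤ c e))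
          (≋-sym (*ᵖ-∷ʳ [ c ]ᶜ 0ℚ (xpow e)))

coeff-xpow-≢ : ∀ e {j} → j ≢ e → coeff (xpow e) j ≡ 0ℚ
coeff-xpow-≢ zero    {zero}  j≢e = ⊥-elim (j≢e refl)
coeff-xpow-≢ zero    {suc j} _   = refl
coeff-xpow-≢ (suc e) {zero}  _   = refl
coeff-xpow-≢ (suc e) {suc j} j≢e = coeff-xpow-≢ e (j≢e ∘ cong suc)

xpow-*ᵖ : ∀ e f → xpow e *ᵖ xpow f ≋ xpow (e ℕ.+ f)
xpow-*ᵖ zero    f = *ᵖ-identityˡ (xpow f)
xpow-*ᵖ (suc e) f = ≋-trans (0∷-*ᵖ (xpow e) (xpow f)) (∷-cong refl (xpow-*ᵖ e f))

compose-congʳ : ∀ h {g g′} → g ≋ g′ → compose h g ≋ compose h g′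
compose-congʳ []      _ = ≋-refl
compose-congʳ (a ∷ h) e = +ᵖ-cong ≋-refl (*ᵖ-cong e (compose-congʳ h e))

NonZeroᵖ : QPoly → Set
NonZeroᵖ q = ∃[ j ] coeff q j ≢ 0ℚ

nonZeroᵖ? : ∀ q → NonZeroᵖ q ⊎ q ≋ []
nonZeroᵖ? []      = inj₂ ≋-refl
nonZeroᵖ? (a ∷ q) with a ℚP.≟ 0ℚ
... | no  a≢0 = inj₁ (0 , a≢0)
... | yes a≡0 with nonZeroᵖ? q
...   | inj₁ (j , qⱼ≢0) = inj₁ (suc j , qⱼ≢0)
...   | inj₂ q≋[]       = inj₂ (≋-trans (∷-cong a≡0 q≋[]) [0]≋[])

*-≢0 : ∀ {a b} → a ≢ 0ℚ → b ≢ 0ℚ → a ℚ.* b ≢ 0ℚ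
*-≢0 {a} {b} a≢0 b≢0 ab≡0 = b≢0 (begin
  b                      ≡⟨ ℚP.*-identityˡ b ⟨
  1ℚ ℚ.* b               ≡⟨ cong (ℚ._* b) (ℚP.*-inverseˡ a) ⟨
  a⁻¹ ℚ.* a ℚ.* b        ≡⟨ ℚP.*-assoc a⁻¹ a b ⟩
  a⁻¹ ℚ.* (a ℚ.* b)      ≡⟨ cong (a⁻¹ ℚ.*_) ab≡0 ⟩
  a⁻¹ ℚ.* 0ℚ             ≡⟨ ℚP.*-zeroʳ a⁻¹ ⟩
  0ℚ                     ∎)
  where
  open ≡-Reasoning
  instance
    a-nonZero : ℚ.NonZero a
    a-nonZero = ℚ.≢-nonZero a≢0
  a⁻¹ : ℚ
  a⁻¹ = ℚ.1/ a

module _ {f : QPoly} {d : ℕ} (f-d≢0 : coeff f d ≢ 0ℚ) (f-vanishes : ∀ j → d < j → coeff f j ≡ 0ℚ) where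

  -- The witness is d plus the index of the last nonzero coefficient of q.
  *ᵖ-reaches-degree : ∀ q → NonZeroᵖ q → ∃[ j ] d ≤ j × coeff (q *ᵖ f) j ≢ 0ℚ
  *ᵖ-reaches-degree []      (_ , 0≢0) = ⊥-elim (0≢0 refl)
  *ᵖ-reaches-degree (a ∷ q) (i , aq≢0) with nonZeroᵖ? q
  ... | inj₁ q≢0 with *ᵖ-reaches-degree q q≢0
  ...   | j , d≤j , [qf]ⱼ≢0 = suc j , ℕP.m≤n⇒m≤1+n d≤j , λ [aqf]ⱼ₊₁≡0 → [qf]ⱼ≢0 (begin
    coeff (q *ᵖ f) j                               ≡⟨ ℚP.+-identityˡ _ ⟨
    0ℚ ℚ.+ coeff (q *ᵖ f) j                        ≡⟨ cong (ℚ._+ coeff (q *ᵖ f) j) a·fⱼ₊₁≡0 ⟨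
    a ℚ.* coeff f (suc j) ℚ.+ coeff (q *ᵖ f) j     ≡⟨ coeff-∷-*ᵖ a q f (suc j) ⟨
    coeff ((a ∷ q) *ᵖ f) (suc j)                   ≡⟨ [aqf]ⱼ₊₁≡0 ⟩
    0ℚ                                             ∎)
    where
    open ≡-Reasoning
    a·fⱼ₊₁≡0 : a ℚ.* coeff f (suc j) ≡ 0ℚ
    a·fⱼ₊₁≡0 = trans (cong (a ℚ.*_) (f-vanishes (suc j) (ℕ.s≤s d≤j))) (ℚP.*-zeroʳ a)
  *ᵖ-reaches-degree (a ∷ q) (i , aq≢0) | inj₂ q≋[] = d , ℕP.≤-refl , λ [aqf]_d≡0 →
    *-≢0 (head≢0 i aq≢0) f-d≢0 (begin
      a ℚ.* coeff f d                               ≡⟨ ℚP.+-identityʳ _ ⟨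
      a ℚ.* coeff f d ℚ.+ 0ℚ                        ≡⟨ cong (a ℚ.* coeff f d ℚ.+_) (tail≈0 d) ⟨
      a ℚ.* coeff f d ℚ.+ coeff (0ℚ ∷ (q *ᵖ f)) d   ≡⟨ coeff-∷-*ᵖ a q f d ⟨
      coeff ((a ∷ q) *ᵖ f) d                        ≡⟨ [aqf]_d≡0 ⟩
      0ℚ                                            ∎)
    where
    open ≡-Reasoning
    head≢0 : ∀ i → coeff (a ∷ q) i ≢ 0ℚ → a ≢ 0ℚ
    head≢0 zero    a≢0  = a≢0
    head≢0 (suc i) qᵢ≢0 = λ _ → qᵢ≢0 (coeff-≡ q≋[] i)
    tail≈0 : ∀ k → coeff (0ℚ ∷ (q *ᵖ f)) k ≡ 0ℚ
    tail≈0 zero    = refl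
    tail≈0 (suc k) = coeff-≡ (*ᵖ-zeroˡ f q≋[]) k

  ¬∣ᵖ-lowerDegree : ∀ {P} → NonZeroᵖ P → (∀ j → d ≤ j → coeff P j ≡ 0ℚ) → ¬ (f ∣ᵖ P)
  ¬∣ᵖ-lowerDegree {P} (i , Pᵢ≢0) P-vanishes (q , P≈qf) with nonZeroᵖ? q
  ... | inj₂ q≋[] = Pᵢ≢0 (trans (P≈qf i) (coeff-≡ (*ᵖ-zeroˡ f q≋[]) i))
  ... | inj₁ q≢0 with *ᵖ-reaches-degree q q≢0
  ...   | j , d≤j , [qf]ⱼ≢0 = [qf]ⱼ≢0 (trans (sym (P≈qf j)) (P-vanishes j d≤j))

nonIntegral⇒¬PowerBasisIsZBasis :
  ∀ {f d} → IsDegreeℤ f d → ∀ {g} i → IsAlgInt f g → (∀ j → d ≤ j → coeff g j ≡ 0ℚ) →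
  (∀ c → coeff g i ≢ ι c) → ¬ PowerBasisIsZBasis f d
nonIntegral⇒¬PowerBasisIsZBasis {f} {d} (f-d≢0 , f-vanishes) {g} i g-int g-vanishes gᵢ∉ℤ (_ , _ , represent)
  with represent g g-int
... | c , f∣g-c = ¬∣ᵖ-lowerDegree {toQ f} {d} toQf-d≢0 toQf-vanishes {g -ᵖ linComb c} (i , [g-c]ᵢ≢0) g-c-vanishes f∣g-c
  where
  toQf-d≢0 : coeff (toQ f) d ≢ 0ℚ
  toQf-d≢0 = f-d≢0 ∘ ι≡0⇒≡0 _ ∘ trans (sym (coeff-toQ f d))

  toQf-vanishes : ∀ j → d < j → coeff (toQ f) j ≡ 0ℚ
  toQf-vanishes j d<j = trans (coeff-toQ f j) (cong ι (f-vanishes j d<j))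

  cs : List ℤ
  cs = Vec.toList c

  coeff-g-c : ∀ j → coeff (g -ᵖ linComb c) j ≡ coeff g j ℚ.- ι (coeffℤ cs j)
  coeff-g-c j = trans (coeff--ᵖ-distrib g (linComb c) j) (cong (λ x → coeff g j ℚ.- x) (coeff-toQ cs j))

  [g-c]ᵢ≢0 : coeff (g -ᵖ linComb c) i ≢ 0ℚ
  [g-c]ᵢ≢0 = gᵢ∉ℤ (coeffℤ cs i) ∘ x∙y⁻¹≈ε⇒x≈y _ _ ∘ trans (sym (coeff-g-c i))

  g-c-vanishes : ∀ j → d ≤ j → coeff (g -ᵖ linComb c) j ≡ 0ℚ
  g-c-vanishes j d≤j = begin
    coeff (g -ᵖ linComb c) j           ≡⟨ coeff-g-c j ⟩
    coeff g j ℚ.- ι (coeffℤ cs j)      ≡⟨ cong₂ (λ x y → x ℚ.- ι y) (g-vanishes j d≤j) cs-vanishes ⟩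
    0ℚ                                 ∎
    where
    open ≡-Reasoning
    cs-vanishes : coeffℤ cs j ≡ + 0
    cs-vanishes = coeffℤ-≥length cs (subst (_≤ j) (sym (VecP.length-toList c)) d≤j)

unit-*ᵖ-∣ᵖ : ∀ {a b X Y f} → b ℚ.* a ≡ 1ℚ → (a ∷ []) *ᵖ X ≋ Y *ᵖ f → f ∣ᵖ X
unit-*ᵖ-∣ᵖ {a} {b} {X} {Y} {f} ba≡1 aX≋Yf = (b ∷ []) *ᵖ Y , coeff-≡ (begin
  X                              ≈⟨ *ᵖ-identityˡ X ⟨
  1ᵖ *ᵖ X                        ≈⟨ *ᵖ-congʳ X ba≋1 ⟨
  ((b ∷ []) *ᵖ (a ∷ [])) *ᵖ X    ≈⟨ *ᵖ-assoc (b ∷ []) (a ∷ []) X ⟩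
  (b ∷ []) *ᵖ ((a ∷ []) *ᵖ X)    ≈⟨ *ᵖ-congˡ (b ∷ []) aX≋Yf ⟩
  (b ∷ []) *ᵖ (Y *ᵖ f)           ≈⟨ *ᵖ-assoc (b ∷ []) Y f ⟨
  ((b ∷ []) *ᵖ Y) *ᵖ f           ∎)
  where
  open import Relation.Binary.Reasoning.Setoid ≋-setoid
  ba≋1 : (b ∷ []) *ᵖ (a ∷ []) ≋ 1ᵖ
  ba≋1 = ∷-cong (trans (ℚP.+-identityʳ (b ℚ.* a)) ba≡1) ≋-refl

-- Coefficients in y (constant term first), each a polynomial in κ.
ℤ[κ][y] : Set
ℤ[κ][y] = List (List ℤ)

evalℤ : List ℤ → ℤ → ℤ
evalℤ []       k = + 0
evalℤ (c ∷ cs) k = c ℤ.+ k ℤ.* evalℤ cs k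

specialise : ℤ[κ][y] → ℤ → ZPoly
specialise P k = map (λ cs → evalℤ cs k) P

y κ : Expr ℤ 2
y = Ι zero
κ = Ι (suc zero)

polyκ : List ℤ → Expr ℤ 2
polyκ []       = Κ (+ 0)
polyκ (c ∷ cs) = Κ c ⊕ κ ⊗ polyκ cs

_∘ᴱ_ : ℤ[κ][y] → Expr ℤ 2 → Expr ℤ 2
[]       ∘ᴱ t = Κ (+ 0)
(cs ∷ P) ∘ᴱ t = polyκ cs ⊕ t ⊗ (P ∘ᴱ t)

compose-specialise : ∀ P k t g → compose (specialise P k) (⟦ t ⟧ (g ∷ [ k ]ᶜ ∷ [])) ≋ ⟦ P ∘ᴱ t ⟧ (g ∷ [ k ]ᶜ ∷ [])
compose-specialise []       k t g = ≋-sym [0]≋[]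
compose-specialise (cs ∷ P) k t g =
  +ᵖ-cong (evalℤ≋polyκ cs) (*ᵖ-congˡ (⟦ t ⟧ ρ) (compose-specialise P k t g))
  where
  ρ : Vec QPoly 2
  ρ = g ∷ [ k ]ᶜ ∷ []
  evalℤ≋polyκ : ∀ cs → [ evalℤ cs k ]ᶜ ≋ ⟦ polyκ cs ⟧ ρ
  evalℤ≋polyκ []       = ≋-refl
  evalℤ≋polyκ (c ∷ cs) = ≋-trans ([]ᶜ-+ c (k ℤ.* evalℤ cs k))
    (+ᵖ-cong (≋-refl {[ c ]ᶜ}) (≋-trans ([]ᶜ-* k (evalℤ cs k)) (*ᵖ-congˡ [ k ]ᶜ (evalℤ≋polyκ cs))))

-- h(y) ∈ ℤ[κ][y]: monic of degree 8 in y; its integrality is where A ≡ 1 (mod 4) enters.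
h : ℤ[κ][y]
h = (+ 0 ∷ + 0 ∷ + 0 ∷ + 0 ∷ + 5 ∷ + 12 ∷ [])
  ∷ (+ 0 ∷ + 0 ∷ + 0 ∷ + 0 ∷ -[1+ 39 ] ∷ -[1+ 95 ] ∷ [])
  ∷ (+ 0 ∷ + 0 ∷ + 5 ∷ + 0 ∷ + 120 ∷ + 352 ∷ [])
  ∷ (+ 0 ∷ + 0 ∷ -[1+ 29 ] ∷ + 0 ∷ -[1+ 159 ] ∷ -[1+ 767 ] ∷ [])
  ∷ (+ 1 ∷ + 0 ∷ + 65 ∷ + 0 ∷ + 80 ∷ + 1024 ∷ [])
  ∷ (-[1+ 3 ] ∷ + 0 ∷ -[1+ 59 ] ∷ + 0 ∷ + 0 ∷ -[1+ 767 ] ∷ [])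
  ∷ (+ 6 ∷ + 0 ∷ + 20 ∷ + 0 ∷ + 0 ∷ + 256 ∷ [])
  ∷ (-[1+ 3 ] ∷ [])
  ∷ (+ 1 ∷ [])
  ∷ []

-- ĥ(w) = 2⁸ h(w/2): the coefficient of yⁱ is multiplied by 2^(8 - i).
ĥ : ℤ[κ][y]
ĥ = rescale 8 h
  where
  rescale : ℕ → ℤ[κ][y] → ℤ[κ][y]
  rescale e []       = []
  rescale e (cs ∷ P) = map (+ (2 ^ e) ℤ.*_) cs ∷ rescale (e ℕ.∸ 1) P

Q : ℤ[κ][y]
Q = (+ 1 ∷ [])
  ∷ (+ 0 ∷ [])
  ∷ (-[1+ 0 ] ∷ -[1+ 3 ] ∷ [])
  ∷ (+ 0 ∷ [])
  ∷ (+ 0 ∷ + 4 ∷ + 16 ∷ [])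
  ∷ (+ 0 ∷ [])
  ∷ (+ 0 ∷ + 0 ∷ -[1+ 15 ] ∷ -[1+ 63 ] ∷ [])
  ∷ (+ 0 ∷ [])
  ∷ (+ 0 ∷ + 4 ∷ + 0 ∷ + 64 ∷ + 256 ∷ [])
  ∷ (+ 0 ∷ [])
  ∷ (-[1+ 2 ] ∷ -[1+ 3 ] ∷ + 48 ∷ + 0 ∷ -[1+ 255 ] ∷ [])
  ∷ (+ 0 ∷ [])
  ∷ (+ 3 ∷ + 8 ∷ -[1+ 47 ] ∷ -[1+ 127 ] ∷ [])
  ∷ (+ 0 ∷ [])
  ∷ (+ 0 ∷ -[1+ 7 ] ∷ -[1+ 15 ] ∷ + 128 ∷ + 256 ∷ [])
  ∷ (+ 0 ∷ [])
  ∷ (+ 0 ∷ + 0 ∷ + 32 ∷ + 0 ∷ -[1+ 255 ] ∷ [])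
  ∷ (+ 0 ∷ [])
  ∷ (+ 0 ∷ -[1+ 7 ] ∷ -[1+ 15 ] ∷ + 128 ∷ + 256 ∷ [])
  ∷ (+ 0 ∷ [])
  ∷ (+ 3 ∷ + 8 ∷ -[1+ 47 ] ∷ -[1+ 127 ] ∷ [])
  ∷ (+ 0 ∷ [])
  ∷ (-[1+ 2 ] ∷ -[1+ 3 ] ∷ + 48 ∷ + 0 ∷ -[1+ 255 ] ∷ [])
  ∷ (+ 0 ∷ [])
  ∷ (+ 0 ∷ + 4 ∷ + 0 ∷ + 64 ∷ + 256 ∷ [])
  ∷ (+ 0 ∷ [])
  ∷ (+ 0 ∷ + 0 ∷ -[1+ 15 ] ∷ -[1+ 63 ] ∷ [])
  ∷ (+ 0 ∷ [])
  ∷ (+ 0 ∷ + 4 ∷ + 16 ∷ [])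
  ∷ (+ 0 ∷ [])
  ∷ (-[1+ 0 ] ∷ -[1+ 3 ] ∷ [])
  ∷ (+ 0 ∷ [])
  ∷ (+ 1 ∷ [])
  ∷ []

Aᴱ : Expr ℤ 2
Aᴱ = Κ (+ 1) ⊕ κ ⊗ Κ (+ 4)

G : Expr ℤ 2
G = y ⊛ 8 ⊕ Aᴱ ⊗ y ⊛ 6 ⊕ Aᴱ ⊗ y ⊛ 4 ⊕ Aᴱ ⊗ y ⊛ 2 ⊕ Κ (+ 1)

2⁸h[y]≋ĥ[2y] : ∀ ρ → ⟦ Κ (+ 256) ⊗ (h ∘ᴱ y) ⟧ ρ ≋ ⟦ ĥ ∘ᴱ (Κ (+ 2) ⊗ y) ⟧ ρ
2⁸h[y]≋ĥ[2y] ρ = prove ρ (Κ (+ 256) ⊗ (h ∘ᴱ y)) (ĥ ∘ᴱ (Κ (+ 2) ⊗ y)) ≋-refl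

ĥ[1+y⁵]≋Q[y]G[y] : ∀ ρ → ⟦ ĥ ∘ᴱ (Κ (+ 1) ⊕ y ⊛ 5) ⟧ ρ ≋ ⟦ (Q ∘ᴱ y) ⊗ G ⟧ ρ
ĥ[1+y⁵]≋Q[y]G[y] ρ = prove ρ (ĥ ∘ᴱ (Κ (+ 1) ⊕ y ⊛ 5)) ((Q ∘ᴱ y) ⊗ G) ≋-refl

module NonIntegralElement (m : ℕ) (k : ℤ) where

  r : ℕ
  r = 2 ^ m

  instance
    r≢0 : ℕ.NonZero r
    r≢0 = ℕP.m^n≢0 2 m

  <ᵇ⇒*r<*r : ∀ a b → T (a ℕ.<ᵇ b) → a ℕ.* r < b ℕ.* r
  <ᵇ⇒*r<*r a b a<ᵇb = ℕP.*-monoˡ-< r (ℕP.<ᵇ⇒< a b a<ᵇb)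

  2^[3+m]≡8r : 2 ^ (3 ℕ.+ m) ≡ 8 ℕ.* r
  2^[3+m]≡8r = ℕP.^-distribˡ-+-* 2 3 m

  ρ : QPoly → Vec QPoly 2
  ρ g = g ∷ [ k ]ᶜ ∷ []

  y^j≋x^[jr] : ∀ j → ⟦ y ⊛ j ⟧ (ρ (xpow r)) ≋ xpow (j ℕ.* r)
  y^j≋x^[jr] zero          = ≋-refl
  y^j≋x^[jr] (suc zero)    = ≋-reflexive (cong xpow (sym (ℕP.+-identityʳ r)))
  y^j≋x^[jr] (suc (suc j)) =
    ≋-trans (*ᵖ-congʳ (xpow r) (y^j≋x^[jr] (suc j)))
            (≋-trans (xpow-*ᵖ (suc j ℕ.* r) r) (≋-reflexive (cong xpow (ℕP.+-comm (suc j ℕ.* r) r))))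

  Φ α : QPoly
  Φ = ⟦ Κ (+ 1) ⊕ y ⊛ 5 ⟧ (ρ (xpow r))
  α = scale ½ Φ

  2α≋Φ : [ + 2 ]ᶜ *ᵖ α ≋ Φ
  2α≋Φ = coeffwise λ j → begin
    coeff ([ + 2 ]ᶜ *ᵖ α) j         ≡⟨ coeff-≡ (∷[]-*ᵖ (ι (+ 2)) α) j ⟩
    coeff (scale (ι (+ 2)) α) j     ≡⟨ coeff-scale (ι (+ 2)) α j ⟩
    ι (+ 2) ℚ.* coeff α j           ≡⟨ cong (ι (+ 2) ℚ.*_) (coeff-scale ½ Φ j) ⟩
    ι (+ 2) ℚ.* (½ ℚ.* coeff Φ j)   ≡⟨ ℚP.*-assoc (ι (+ 2)) ½ (coeff Φ j) ⟨
    1ℚ ℚ.* coeff Φ j                ≡⟨ ℚP.*-identityˡ (coeff Φ j) ⟩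
    coeff Φ j                       ∎
    where open ≡-Reasoning

  coeff-α : ∀ j → coeff α j ≡ ½ ℚ.* (coeff [ + 1 ]ᶜ j ℚ.+ coeff (xpow (5 ℕ.* r)) j)
  coeff-α j = trans (coeff-scale ½ Φ j)
    (cong (½ ℚ.*_) (trans (coeff-≡ (+ᵖ-cong (≋-refl {[ + 1 ]ᶜ}) (y^j≋x^[jr] 5)) j) (coeff-+ᵖ [ + 1 ]ᶜ (xpow (5 ℕ.* r)) j)))

  α₀∉ℤ : ∀ c → coeff α 0 ≢ ι c
  α₀∉ℤ c α₀≡ιc = ½≢ι c (begin
    ½                                                     ≡⟨ ℚP.*-identityʳ ½ ⟨
    ½ ℚ.* (1ℚ ℚ.+ 0ℚ)                                     ≡⟨ cong (λ x → ½ ℚ.* (1ℚ ℚ.+ x)) x^[5r]₀≡0 ⟨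
    ½ ℚ.* (coeff [ + 1 ]ᶜ 0 ℚ.+ coeff (xpow (5 ℕ.* r)) 0)  ≡⟨ coeff-α 0 ⟨
    coeff α 0                                             ≡⟨ α₀≡ιc ⟩
    ι c                                                   ∎)
    where
    open ≡-Reasoning
    x^[5r]₀≡0 : coeff (xpow (5 ℕ.* r)) 0 ≡ 0ℚ
    x^[5r]₀≡0 = coeff-xpow-≢ (5 ℕ.* r) (ℕP.<⇒≢ (<ᵇ⇒*r<*r 0 5 _))

  α-vanishes : ∀ {d} → 8 ℕ.* r ≤ d → ∀ j → d ≤ j → coeff α j ≡ 0ℚ
  α-vanishes {d} 8r≤d j d≤j = begin
    coeff α j                                              ≡⟨ coeff-α j ⟩
    ½ ℚ.* (coeff [ + 1 ]ᶜ j ℚ.+ coeff (xpow (5 ℕ.* r)) j)  ≡⟨ cong₂ (λ a b → ½ ℚ.* (a ℚ.+ b)) ([1]ⱼ≡0 0<j) x^[5r]ⱼ≡0 ⟩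
    ½ ℚ.* (0ℚ ℚ.+ 0ℚ)                                      ≡⟨ ℚP.*-zeroʳ ½ ⟩
    0ℚ                                                     ∎
    where
    open ≡-Reasoning
    5r<j : 5 ℕ.* r < j
    5r<j = ℕP.<-≤-trans (<ᵇ⇒*r<*r 5 8 _) (ℕP.≤-trans 8r≤d d≤j)
    0<j : 0 < j
    0<j = ℕP.≤-<-trans ℕ.z≤n 5r<j
    x^[5r]ⱼ≡0 : coeff (xpow (5 ℕ.* r)) j ≡ 0ℚ
    x^[5r]ⱼ≡0 = coeff-xpow-≢ (5 ℕ.* r) (ℕP.<⇒≢ 5r<j ∘ sym)
    [1]ⱼ≡0 : ∀ {j} → 0 < j → coeff [ + 1 ]ᶜ j ≡ 0ℚ
    [1]ⱼ≡0 (ℕ.s≤s _) = refl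

  +1≢+0 : + 1 ≢ + 0
  +1≢+0 ()

  hₖ : ZPoly
  hₖ = specialise h k

  hₖ-monic : Monicℤ hₖ
  hₖ-monic = 8 , (+1≢+0 ∘ trans (sym hₖ-8≡1) , λ j 8<j → coeffℤ-≥length hₖ 8<j) , hₖ-8≡1
    where
    hₖ-8≡1 : coeffℤ hₖ 8 ≡ + 1
    hₖ-8≡1 = cong (ℤ._+_ (+ 1)) (ℤP.*-zeroʳ k)

  F-top : ∀ A → coeffℤ (F (3 ℕ.+ m) A) (2 ^ (3 ℕ.+ m)) ≡ + 1
  F-top A = begin
    coeffℤ (x⁸ +ᶻ Ax⁶ +ᶻ Ax⁴ +ᶻ Ax² +ᶻ monℤ (+ 1) 0) E  ≡⟨ coeffℤ-+ᶻ-monℤ-< (x⁸ +ᶻ Ax⁶ +ᶻ Ax⁴ +ᶻ Ax²) (+ 1) (ℕP.m^n>0 2 (3 ℕ.+ m)) ⟩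
    coeffℤ (x⁸ +ᶻ Ax⁶ +ᶻ Ax⁴ +ᶻ Ax²) E                  ≡⟨ coeffℤ-+ᶻ-monℤ-< (x⁸ +ᶻ Ax⁶ +ᶻ Ax⁴) A (below 2 _ refl) ⟩
    coeffℤ (x⁸ +ᶻ Ax⁶ +ᶻ Ax⁴) E                         ≡⟨ coeffℤ-+ᶻ-monℤ-< (x⁸ +ᶻ Ax⁶) A (below 4 _ (sym (ℕP.*-assoc 2 2 r))) ⟩
    coeffℤ (x⁸ +ᶻ Ax⁶) E                                ≡⟨ coeffℤ-+ᶻ-monℤ-< x⁸ A (below 6 _ (sym (ℕP.*-assoc 3 2 r))) ⟩
    coeffℤ x⁸ E                                         ≡⟨ coeffℤ-monℤ-≡ (+ 1) E ⟩
    + 1                                                 ∎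
    where
    open ≡-Reasoning
    E : ℕ
    E = 2 ^ (3 ℕ.+ m)
    x⁸ Ax⁶ Ax⁴ Ax² : ZPoly
    x⁸ = monℤ (+ 1) E
    Ax⁶ = monℤ A (3 ℕ.* 2 ^ suc m)
    Ax⁴ = monℤ A (2 ^ suc (suc m))
    Ax² = monℤ A (2 ^ suc m)
    below : ∀ {e} j → T (j ℕ.<ᵇ 8) → e ≡ j ℕ.* r → e < E
    below j j<ᵇ8 refl = subst (j ℕ.* r <_) (sym 2^[3+m]≡8r) (<ᵇ⇒*r<*r j 8 j<ᵇ8)

  8r≤degree : ∀ {A d} → IsDegreeℤ (F (3 ℕ.+ m) A) d → 8 ℕ.* r ≤ d
  8r≤degree {A} {d} deg =
    subst (_≤ d) 2^[3+m]≡8r (coeffℤ≢0⇒≤degree {F (3 ℕ.+ m) A} deg (+1≢+0 ∘ trans (sym (F-top A))))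

  module _ (A : ℤ) (A≡1+4k : A ≡ + 1 ℤ.+ k ℤ.* + 4) where

    monomial : ∀ c {e} j → e ≡ j ℕ.* r → toQ (monℤ c e) ≋ [ c ]ᶜ *ᵖ ⟦ y ⊛ j ⟧ (ρ (xpow r))
    monomial c j refl = ≋-trans (toQ-monℤ c _) (*ᵖ-congˡ [ c ]ᶜ (≋-sym (y^j≋x^[jr] j)))

    [A]≋Aᴱ : [ A ]ᶜ ≋ ⟦ Aᴱ ⟧ (ρ (xpow r))
    [A]≋Aᴱ = ≋-trans (≋-reflexive (cong [_]ᶜ A≡1+4k)) (≋-trans ([]ᶜ-+ (+ 1) (k ℤ.* + 4)) (+ᵖ-cong (≋-refl {[ + 1 ]ᶜ}) ([]ᶜ-* k (+ 4))))

    Ay^j : ∀ {e} j → e ≡ j ℕ.* r → toQ (monℤ A e) ≋ ⟦ Aᴱ ⊗ y ⊛ j ⟧ (ρ (xpow r))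
    Ay^j j e≡jr = ≋-trans (monomial A j e≡jr) (*ᵖ-congʳ _ [A]≋Aᴱ)

    toQ-F≋G[x^r] : toQ (F (3 ℕ.+ m) A) ≋ ⟦ G ⟧ (ρ (xpow r))
    toQ-F≋G[x^r] =
      toQ-+ᶻ (toQ-+ᶻ (toQ-+ᶻ (toQ-+ᶻ (≋-trans (monomial (+ 1) 8 2^[3+m]≡8r) (*ᵖ-identityˡ _))
                                      (Ay^j 6 (sym (ℕP.*-assoc 3 2 r))))
                              (Ay^j 4 (sym (ℕP.*-assoc 2 2 r))))
                      (Ay^j 2 refl))
             ≋-refl

    α-isAlgInt : IsAlgInt (F (3 ℕ.+ m) A) α
    α-isAlgInt = hₖ , hₖ-monic , unit-*ᵖ-∣ᵖ {b = + 1 ℚ./ 256} {Y = ⟦ Q ∘ᴱ y ⟧ (ρ (xpow r))} refl (begin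
      [ + 256 ]ᶜ *ᵖ compose hₖ α                      ≈⟨ *ᵖ-congˡ [ + 256 ]ᶜ (compose-specialise h k y α) ⟩
      ⟦ Κ (+ 256) ⊗ (h ∘ᴱ y) ⟧ (ρ α)                 ≈⟨ 2⁸h[y]≋ĥ[2y] (ρ α) ⟩
      ⟦ ĥ ∘ᴱ (Κ (+ 2) ⊗ y) ⟧ (ρ α)                   ≈⟨ compose-specialise ĥ k (Κ (+ 2) ⊗ y) α ⟨
      compose ĥₖ ([ + 2 ]ᶜ *ᵖ α)                      ≈⟨ compose-congʳ ĥₖ 2α≋Φ ⟩
      compose ĥₖ Φ                                    ≈⟨ compose-specialise ĥ k (Κ (+ 1) ⊕ y ⊛ 5) (xpow r) ⟩
      ⟦ ĥ ∘ᴱ (Κ (+ 1) ⊕ y ⊛ 5) ⟧ (ρ (xpow r))         ≈⟨ ĥ[1+y⁵]≋Q[y]G[y] (ρ (xpow r)) ⟩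
      ⟦ Q ∘ᴱ y ⟧ (ρ (xpow r)) *ᵖ ⟦ G ⟧ (ρ (xpow r))   ≈⟨ *ᵖ-congˡ (⟦ Q ∘ᴱ y ⟧ (ρ (xpow r))) toQ-F≋G[x^r] ⟨
      ⟦ Q ∘ᴱ y ⟧ (ρ (xpow r)) *ᵖ toQ (F (3 ℕ.+ m) A)  ∎)
      where
      open import Relation.Binary.Reasoning.Setoid ≋-setoid
      ĥₖ : ZPoly
      ĥₖ = specialise ĥ k

theorem1p2 : (n : ℕ) → 3 ≤ n → (A : ℤ) → (+ 4) ∣ (A - + 1) → ¬ Monogenic (F n A)
theorem1p2 (suc zero) (ℕ.s≤s ())
theorem1p2 (suc (suc zero)) (ℕ.s≤s (ℕ.s≤s ()))
theorem1p2 (suc (suc (suc m))) _ A 4∣A-1 (_ , d , deg , basis) with ∣ᵤ⇒∣ {i = A - + 1} 4∣A-1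
... | divides k A-1≡k*4 =
  nonIntegral⇒¬PowerBasisIsZBasis deg 0 (α-isAlgInt A A≡1+4k) (α-vanishes (8r≤degree deg)) α₀∉ℤ basis
  where
  open NonIntegralElement m k
  A≡1+[A-1] : A ≡ + 1 ℤ.+ (A - + 1)
  A≡1+[A-1] = solve 1 (λ A → A := con (+ 1) :+ (A :- con (+ 1))) refl A
    where open ℤSolver.+-*-Solver
  A≡1+4k : A ≡ + 1 ℤ.+ k ℤ.* + 4
  A≡1+4k = trans A≡1+[A-1] (cong (ℤ._+_ (+ 1)) A-1≡k*4)
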